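{- Let $G$ be a finite simple graph with $p\ge1$ vertices and $q$ edges, and write $q=tp+t_0$ with $t$ a nonnegative integer and $0\le t_0\le p-1$. Then the double graph $\mathcal{D}[G]$ is max-$\kappa$ if and only if $G$ is max-$\kappa$ and either $0\le t_0<\frac{p}{4}$ or $\frac{p}{2}\le t_0<\frac{3p}{4}$.
   Context: The total graph $T_2$ is $K_2$ with a loop added at each of its two vertices. The double graph is $\mathcal{D}[G]=G\times T_2$ (Kronecker product): it has vertex set $V(G)\times\{0,1\}$ and $(u,i)$ is adjacent to $(v,j)$ iff $uv\in E(G)$. For a graph $H$ with $p(H)\ge1$ vertices and $q(H)$ edges, $H$ is called max-$\kappa$ if $\kappa(H)=\lfloor 2q(H)/p(H)\rfloor$, where $\kappa$ is vertex-connectivity. -}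

module Defs where

open import Data.Nat using (ℕ; zero; suc; _+_; _*_; _∸_; _≤_; _<_; NonZero)
open import Data.Nat.DivMod using (_/_)
open import Data.Fin using (Fin; toℕ; splitAt)
open import Data.Fin.Subset using (Subset; _∈_; _∉_; ∣_∣)
open import Data.Bool using (Bool; true; false; if_then_else_; _∧_)
open import Data.List using (List; map; allFin)
open import Data.Nat.ListAction using (sum)
open import Data.Sum using (_⊎_; [_,_])
open import Data.Product using (Σ; ∃; _×_; _,_)
open import Relation.Nullary using (¬_)
open import Relation.Nullary.Decidable using (⌊_⌋)
open import Relation.Binary.PropositionalEquality using (_≡_; refl)
open import Function using (id)

record Graph (n : ℕ) : Set where
  field
    adj    : Fin n → Fin n → Bool
    sym    : ∀ i j → adj i j ≡ adj j i
    irrefl : ∀ i → adj i i ≡ false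
open Graph public

edgeCount : ∀ {n} → Graph n → ℕ
edgeCount {n} G =
  sum (map (λ i → sum (map (λ j →
    if ⌊ toℕ i Data.Nat.<? toℕ j ⌋ ∧ adj G i j then 1 else 0) (allFin n))) (allFin n))

data Reach {n} (G : Graph n) (S : Subset n) : Fin n → Fin n → Set where
  here : ∀ {u} → Reach G S u u
  step : ∀ {u v w} → adj G u v ≡ true → v ∉ S → Reach G S v w → Reach G S u w

Cut : ∀ {n} → Graph n → Subset n → Set
Cut {n} G S =
  (n ∸ ∣ S ∣ ≤ 1) ⊎
  (Σ (Fin n) λ u → Σ (Fin n) λ v → u ∉ S × v ∉ S × ¬ Reach G S u v)

IsConnectivity : ∀ {n} → Graph n → ℕ → Set
IsConnectivity {n} G k =
  (Σ (Subset n) λ S → ∣ S ∣ ≡ k × Cut G S) ×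
  (∀ (S : Subset n) → Cut G S → k ≤ ∣ S ∣)

MaxKappa : ∀ {n} .{{_ : NonZero n}} → Graph n → Set
MaxKappa {n} G = IsConnectivity G ((2 * edgeCount G) / n)

-- projection of the double graph's vertices Fin (n + n) ≅ Fin n × {0,1}
proj : ∀ {n} → Fin (n + n) → Fin n
proj {n} x = [ id , id ] (splitAt n x)

-- double graph D[G] = G × T₂ : (u,i) ~ (v,j) iff u ~ v in G
double : ∀ {n} → Graph n → Graph (n + n)
double G = record
  { adj    = λ x y → adj G (proj x) (proj y)
  ; sym    = λ x y → sym G (proj x) (proj y)
  ; irrefl = λ x → irrefl G (proj x)
  }

-- Write p for the number of vertices and q for the number of edges of G.  Since D[G] has
-- 2p vertices and 4q edges, it is max-κ iff κ(D[G]) = ⌊4q/p⌋.  A cut S of G doubles to the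
-- cut S × {0,1} of D[G], and a cut T₀ ⊎ T₁ of D[G] (one part per layer) projects to the cut
-- T₀ ∩ T₁ of G, of at most half its size; hence κ(D[G]) = 2κ(G).  Finally
-- ⌊4q/p⌋ = 2⌊2q/p⌋ + ε with ε ∈ {0,1}, and ε = 0 exactly when 2q mod p < p/2, that is when
-- t₀ lies in [0, p/4) ∪ [p/2, 3p/4).

module Submission where

open import Defs renaming (sym to adj-sym)
open import Data.Nat using (ℕ; zero; suc; _+_; _*_; _∸_; _≤_; _<_; z≤n; s≤s; NonZero)
open import Data.Nat.Properties hiding (suc-injective)
open import Data.Nat.DivMod
open import Data.Nat.Divisibility using (n∣m*n)
import Data.Nat.ListAction as ListAction
open import Algebra.Properties.Semiring.Sum +-*-semiring
  using (sum-syntax; sum-cong-≗; ∑-distrib-+; ∑-comm; *-distribˡ-sum)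
open import Data.Fin using (Fin; zero; suc; toℕ; _↑ˡ_; _↑ʳ_; splitAt)
open import Data.Fin.Properties
  using (toℕ-injective; suc-injective; splitAt-↑ˡ; splitAt-↑ʳ; splitAt⁻¹-↑ˡ; splitAt⁻¹-↑ʳ)
  renaming (_≟_ to _≟ᶠ_)
open import Data.Fin.Subset using (Subset; inside; outside; _∈_; _∉_; _⊂_; _∪_; _∩_; ⁅_⁆; ∣_∣)
open import Data.Fin.Subset.Properties
  using (_∈?_; ∣p∣≤n; p⊆p∪q; x∈p∪q⁺; x∈p∪q⁻; x∈⁅x⁆; x∈⁅y⁆⇒x≡y; p⊂q⇒∣p∣<∣q∣; drop-there;
         x∈p∩q⁺; x∈p∩q⁻; ∣p∩q∣≤∣p∣; ∣p∩q∣≤∣q∣; ∩-idem)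
open import Data.Vec using (_∷_; []; _++_; here; there)
import Data.Vec as Vec
open import Data.List using (map; allFin; tabulate)
open import Data.List.Properties using (map-tabulate)
open import Data.Bool using (true; if_then_else_; _∧_)
open import Data.Product using (∃; ∃₂; _×_; _,_; proj₁; proj₂)
import Data.Product as Prod
open import Data.Sum using (_⊎_; inj₁; inj₂; [_,_])
import Data.Sum as Sum
open import Data.Empty using (⊥; ⊥-elim)
open import Function using (id; _∘_)
open import Function.Bundles using (_⇔_; mk⇔; Equivalence)
open import Function.Construct.Composition using (_⇔-∘_)
open import Function.Construct.Identity using (⇔-id)
open import Data.Product.Function.NonDependent.Propositional using (_×-⇔_)
open import Relation.Nullary using (¬_; yes; no; contradiction)
open import Relation.Nullary.Decidable using (decidable-stable; dec-yes-recompute; dec-no; ⌊_⌋)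
open import Relation.Binary.Definitions using (tri<; tri≈; tri>)
open import Relation.Binary.PropositionalEquality hiding ([_])

FirstOrThirdQuarter : ℕ → ℕ → Set
FirstOrThirdQuarter n r = (4 * r < n) ⊎ (n ≤ 2 * r × 4 * r < 3 * n)

[2*m]/n≡[2*[m%n]]/n+2*[m/n] : ∀ m n .{{_ : NonZero n}} →
  (2 * m) / n ≡ (2 * (m % n)) / n + 2 * (m / n)
[2*m]/n≡[2*[m%n]]/n+2*[m/n] m n = begin
  (2 * m) / n                               ≡⟨ /-congˡ (cong (2 *_) (m≡m%n+[m/n]*n m n)) ⟩
  (2 * (r + k * n)) / n                     ≡⟨ /-congˡ (*-distribˡ-+ 2 r (k * n)) ⟩
  (2 * r + 2 * (k * n)) / n                 ≡⟨ /-congˡ (cong (2 * r +_) (*-assoc 2 k n)) ⟨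
  (2 * r + 2 * k * n) / n                   ≡⟨ +-distrib-/-∣ʳ (2 * r) (n∣m*n (2 * k)) ⟩
  (2 * r) / n + 2 * k * n / n               ≡⟨ cong ((2 * r) / n +_) (m*n/n≡m (2 * k) n) ⟩
  (2 * r) / n + 2 * k                       ∎
  where
  open ≡-Reasoning
  r = m % n
  k = m / n

[2*m]/n≡2*k⇔ : ∀ m n k .{{_ : NonZero n}} →
  (2 * m) / n ≡ 2 * k ⇔ (k ≡ m / n × 2 * (m % n) < n)
[2*m]/n≡2*k⇔ m n k = mk⇔ to from
  where
  [2*[m%n]]/n<2 : (2 * (m % n)) / n < 2
  [2*[m%n]]/n<2 = m<n*o⇒m/o<n (*-monoʳ-< 2 (m%n<n m n))

  to : (2 * m) / n ≡ 2 * k → k ≡ m / n × 2 * (m % n) < n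
  to e with (2 * (m % n)) / n in d≡ | [2*[m%n]]/n<2 | trans (sym e) ([2*m]/n≡[2*[m%n]]/n+2*[m/n] m n)
  ... | 0           | _            | 2k≡ = *-cancelˡ-≡ k (m / n) 2 2k≡ , m/n≡0⇒m<n d≡
  ... | 1           | _            | 2k≡ = ⊥-elim (even≢odd k (m / n) 2k≡)
  ... | suc (suc _) | s≤s (s≤s ()) | _

  from : k ≡ m / n × 2 * (m % n) < n → (2 * m) / n ≡ 2 * k
  from (refl , small) = trans ([2*m]/n≡[2*[m%n]]/n+2*[m/n] m n) (cong (_+ 2 * k) (m<n⇒m/n≡0 small))

2*[[2*r]%n]<n⇔ : ∀ r n .{{_ : NonZero n}} → r < n →
  2 * ((2 * r) % n) < n ⇔ FirstOrThirdQuarter n r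
2*[[2*r]%n]<n⇔ r n r<n with 2 * r <? n
... | yes 2r<n rewrite m<n⇒m%n≡m 2r<n =
  mk⇔ (inj₁ ∘ subst (_< n) (sym (*-assoc 2 2 r))) from
  where
  from : FirstOrThirdQuarter n r → 2 * (2 * r) < n
  from (inj₁ 4r<n)       = subst (_< n) (*-assoc 2 2 r) 4r<n
  from (inj₂ (n≤2r , _)) = contradiction 2r<n (≤⇒≯ n≤2r)
... | no 2r≮n = mk⇔ (to ∘ subst (_< n) 2*[2r%n]≡4r∸2n) (subst (_< n) (sym 2*[2r%n]≡4r∸2n) ∘ from)
  where
  n≤2r : n ≤ 2 * r
  n≤2r = ≮⇒≥ 2r≮n

  2n≤4r : 2 * n ≤ 4 * r
  2n≤4r = subst (2 * n ≤_) (sym (*-assoc 2 2 r)) (*-monoʳ-≤ 2 n≤2r)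

  [2r]%n≡2r∸n : (2 * r) % n ≡ 2 * r ∸ n
  [2r]%n≡2r∸n = trans (sym (m≤n⇒[n∸m]%m≡n%m n≤2r))
    (m<n⇒m%n≡m (m<n+o⇒m∸n<o (2 * r) n 2r<n+n))
    where
    2r<n+n : 2 * r < n + n
    2r<n+n = subst (2 * r <_) (cong (n +_) (+-identityʳ n)) (*-monoʳ-< 2 r<n)

  2*[2r%n]≡4r∸2n : 2 * ((2 * r) % n) ≡ 4 * r ∸ 2 * n
  2*[2r%n]≡4r∸2n = begin
    2 * ((2 * r) % n)   ≡⟨ cong (2 *_) [2r]%n≡2r∸n ⟩
    2 * (2 * r ∸ n)     ≡⟨ *-distribˡ-∸ 2 (2 * r) n ⟩
    2 * (2 * r) ∸ 2 * n ≡⟨ cong (_∸ 2 * n) (*-assoc 2 2 r) ⟨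
    4 * r ∸ 2 * n       ∎
    where open ≡-Reasoning

  to : 4 * r ∸ 2 * n < n → FirstOrThirdQuarter n r
  to lt = inj₂ (n≤2r , subst (_< n + 2 * n) (m∸n+n≡m 2n≤4r) (+-monoˡ-< (2 * n) lt))

  from : FirstOrThirdQuarter n r → 4 * r ∸ 2 * n < n
  from (inj₁ 4r<n)        =
    contradiction (≤-<-trans (m≤n*m (2 * r) 2) (subst (_< n) (*-assoc 2 2 r) 4r<n)) 2r≮n
  from (inj₂ (_ , 4r<3n)) = m<n+o⇒m∸n<o (4 * r) (2 * n) (subst (4 * r <_) (+-comm n (2 * n)) 4r<3n)

[2*[4*q]]/[n+n]≡2*k⇔ : ∀ {q t r n} .{{_ : NonZero n}} .{{_ : NonZero (n + n)}} →
  q ≡ t * n + r → r < n → ∀ k →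
  (2 * (4 * q)) / (n + n) ≡ 2 * k ⇔ (k ≡ (2 * q) / n × FirstOrThirdQuarter n r)
[2*[4*q]]/[n+n]≡2*k⇔ {q} {t} {r} {n} q≡ r<n k =
  (⇔-id _ ×-⇔ remainder⇔quarter)
    ⇔-∘ ([2*m]/n≡2*k⇔ (2 * q) n k ⇔-∘ mk⇔ (trans (sym halve)) (trans halve))
  where
  open ≡-Reasoning
  instance _ = m*n≢0 2 n
  halve : (2 * (4 * q)) / (n + n) ≡ (2 * (2 * q)) / n
  halve = begin
    (2 * (4 * q)) / (n + n) ≡⟨ /-congʳ (cong (n +_) (+-identityʳ n)) ⟨
    (2 * (4 * q)) / (2 * n) ≡⟨ m*n/m*o≡n/o 2 (4 * q) n ⟩
    (4 * q) / n             ≡⟨ /-congˡ (*-assoc 2 2 q) ⟩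
    (2 * (2 * q)) / n       ∎
  [2q]%n≡[2r]%n : (2 * q) % n ≡ (2 * r) % n
  [2q]%n≡[2r]%n = begin
    (2 * q) % n               ≡⟨ %-congˡ (cong (2 *_) q≡) ⟩
    (2 * (t * n + r)) % n     ≡⟨ %-congˡ (*-distribˡ-+ 2 (t * n) r) ⟩
    (2 * (t * n) + 2 * r) % n ≡⟨ %-congˡ (+-comm (2 * (t * n)) (2 * r)) ⟩
    (2 * r + 2 * (t * n)) % n ≡⟨ %-congˡ (cong (2 * r +_) (*-assoc 2 t n)) ⟨
    (2 * r + 2 * t * n) % n   ≡⟨ [m+kn]%n≡m%n (2 * r) (2 * t) n ⟩
    (2 * r) % n               ∎
  remainder⇔quarter : 2 * ((2 * q) % n) < n ⇔ FirstOrThirdQuarter n r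
  remainder⇔quarter = subst (λ s → 2 * s < n ⇔ FirstOrThirdQuarter n r) (sym [2q]%n≡[2r]%n)
    (2*[[2*r]%n]<n⇔ r n r<n)

∉⇒p⊂p∪⁅x⁆ : ∀ {n} {p : Subset n} {x} → x ∉ p → p ⊂ p ∪ ⁅ x ⁆
∉⇒p⊂p∪⁅x⁆ {x = x} x∉p = p⊆p∪q ⁅ x ⁆ , x , x∈p∪q⁺ (inj₂ (x∈⁅x⁆ x)) , x∉p

∉-pair⇒2+∣p∣≤n : ∀ {n} {p : Subset n} {x y} → x ≢ y → x ∉ p → y ∉ p → 2 + ∣ p ∣ ≤ n
∉-pair⇒2+∣p∣≤n {n = n} {p = p} {x = x} {y = y} x≢y x∉p y∉p = begin
  2 + ∣ p ∣                ≤⟨ s≤s (p⊂q⇒∣p∣<∣q∣ (∉⇒p⊂p∪⁅x⁆ x∉p)) ⟩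
  suc ∣ p ∪ ⁅ x ⁆ ∣        ≤⟨ p⊂q⇒∣p∣<∣q∣ (∉⇒p⊂p∪⁅x⁆ y∉p∪⁅x⁆) ⟩
  ∣ (p ∪ ⁅ x ⁆) ∪ ⁅ y ⁆ ∣  ≤⟨ ∣p∣≤n ((p ∪ ⁅ x ⁆) ∪ ⁅ y ⁆) ⟩
  n                        ∎
  where
  open ≤-Reasoning
  y∉p∪⁅x⁆ : y ∉ p ∪ ⁅ x ⁆
  y∉p∪⁅x⁆ = [ y∉p , x≢y ∘ sym ∘ x∈⁅y⁆⇒x≡y x ] ∘ x∈p∪q⁻ p ⁅ x ⁆

n∸∣p∣≤1⇒∉-unique : ∀ {n} {p : Subset n} {x y} → n ∸ ∣ p ∣ ≤ 1 → x ∉ p → y ∉ p → x ≡ y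
n∸∣p∣≤1⇒∉-unique {x = x} {y = y} few x∉p y∉p = decidable-stable (x ≟ᶠ y) λ x≢y →
  contradiction few (<⇒≱ (m+n≤o⇒m≤o∸n 2 (∉-pair⇒2+∣p∣≤n x≢y x∉p y∉p)))

∣p∣≡n⊎∃∉ : ∀ {n} (p : Subset n) → ∣ p ∣ ≡ n ⊎ ∃ (_∉ p)
∣p∣≡n⊎∃∉ []            = inj₁ refl
∣p∣≡n⊎∃∉ (outside ∷ p) = inj₂ (zero , λ ())
∣p∣≡n⊎∃∉ (inside ∷ p)  = Sum.map (cong suc) (Prod.map suc (_∘ drop-there)) (∣p∣≡n⊎∃∉ p)

n∸∣p∣≤1⊎∉-pair : ∀ {n} (p : Subset n) → n ∸ ∣ p ∣ ≤ 1 ⊎ ∃₂ λ x y → x ≢ y × x ∉ p × y ∉ p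
n∸∣p∣≤1⊎∉-pair []            = inj₁ z≤n
n∸∣p∣≤1⊎∉-pair (inside ∷ p)  = Sum.map id shift (n∸∣p∣≤1⊎∉-pair p)
  where
  shift : ∃₂ (λ x y → x ≢ y × x ∉ p × y ∉ p) → ∃₂ λ x y → x ≢ y × x ∉ inside ∷ p × y ∉ inside ∷ p
  shift (x , y , x≢y , x∉p , y∉p) =
    suc x , suc y , x≢y ∘ suc-injective , x∉p ∘ drop-there , y∉p ∘ drop-there
n∸∣p∣≤1⊎∉-pair {suc n} (outside ∷ p) with ∣p∣≡n⊎∃∉ p
... | inj₁ ∣p∣≡n       = inj₁ (≤-reflexive (trans (cong (suc n ∸_) ∣p∣≡n) (m+n∸n≡m 1 n)))
... | inj₂ (x , x∉p)   = inj₂ (zero , suc x , (λ ()) , (λ ()) , x∉p ∘ drop-there)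

∣p++q∣≡∣p∣+∣q∣ : ∀ {m n} (p : Subset m) (q : Subset n) → ∣ p ++ q ∣ ≡ ∣ p ∣ + ∣ q ∣
∣p++q∣≡∣p∣+∣q∣ []            q = refl
∣p++q∣≡∣p∣+∣q∣ (inside ∷ p)  q = cong suc (∣p++q∣≡∣p∣+∣q∣ p q)
∣p++q∣≡∣p∣+∣q∣ (outside ∷ p) q = ∣p++q∣≡∣p∣+∣q∣ p q

∣p++p∣≡2*∣p∣ : ∀ {n} (p : Subset n) → ∣ p ++ p ∣ ≡ 2 * ∣ p ∣
∣p++p∣≡2*∣p∣ p = trans (∣p++q∣≡∣p∣+∣q∣ p p) (cong (∣ p ∣ +_) (sym (+-identityʳ ∣ p ∣)))

2*∣p∩q∣≤∣p++q∣ : ∀ {n} (p q : Subset n) → 2 * ∣ p ∩ q ∣ ≤ ∣ p ++ q ∣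
2*∣p∩q∣≤∣p++q∣ p q = begin
  2 * ∣ p ∩ q ∣                ≡⟨ cong (∣ p ∩ q ∣ +_) (+-identityʳ ∣ p ∩ q ∣) ⟩
  ∣ p ∩ q ∣ + ∣ p ∩ q ∣        ≤⟨ +-mono-≤ (∣p∩q∣≤∣p∣ p q) (∣p∩q∣≤∣q∣ p q) ⟩
  ∣ p ∣ + ∣ q ∣                ≡⟨ ∣p++q∣≡∣p∣+∣q∣ p q ⟨
  ∣ p ++ q ∣                   ∎
  where open ≤-Reasoning

∈-++⁺ˡ : ∀ {m n} {p : Subset m} {q : Subset n} {i} → i ∈ p → i ↑ˡ n ∈ p ++ q
∈-++⁺ˡ here       = here
∈-++⁺ˡ (there i∈p) = there (∈-++⁺ˡ i∈p)

∈-++⁻ˡ : ∀ {m n} {p : Subset m} {q : Subset n} i → i ↑ˡ n ∈ p ++ q → i ∈ p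
∈-++⁻ˡ {p = _ ∷ _} zero    here        = here
∈-++⁻ˡ {p = _ ∷ _} (suc i) (there i∈p) = there (∈-++⁻ˡ i i∈p)

∈-++⁺ʳ : ∀ {m n} (p : Subset m) {q : Subset n} {i} → i ∈ q → m ↑ʳ i ∈ p ++ q
∈-++⁺ʳ []      i∈q = i∈q
∈-++⁺ʳ (_ ∷ p) i∈q = there (∈-++⁺ʳ p i∈q)

∈-++⁻ʳ : ∀ {m n} (p : Subset m) {q : Subset n} {i} → m ↑ʳ i ∈ p ++ q → i ∈ q
∈-++⁻ʳ []      i∈q         = i∈q
∈-++⁻ʳ (_ ∷ p) (there i∈q) = ∈-++⁻ʳ p i∈q

data DoubleView (n : ℕ) : Fin (n + n) → Set where
  ↑ˡ-view : ∀ i → DoubleView n (i ↑ˡ n)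
  ↑ʳ-view : ∀ i → DoubleView n (n ↑ʳ i)

doubleView : ∀ {n} x → DoubleView n x
doubleView {n} x with splitAt n x in eq
... | inj₁ i = subst (DoubleView n) (splitAt⁻¹-↑ˡ eq) (↑ˡ-view i)
... | inj₂ i = subst (DoubleView n) (splitAt⁻¹-↑ʳ eq) (↑ʳ-view i)

proj-↑ˡ : ∀ {n} (i : Fin n) → proj (i ↑ˡ n) ≡ i
proj-↑ˡ {n} i rewrite splitAt-↑ˡ n i n = refl

proj-↑ʳ : ∀ {n} (i : Fin n) → proj (n ↑ʳ i) ≡ i
proj-↑ʳ {n} i rewrite splitAt-↑ʳ n n i = refl

∉-++⇒proj∉∩ : ∀ {n} {p q : Subset n} {x} → x ∉ p ++ q → proj x ∉ p ∩ q
∉-++⇒proj∉∩ {n} {p} {q} {x} x∉ with doubleView {n} x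
... | ↑ˡ-view i rewrite proj-↑ˡ i = x∉ ∘ ∈-++⁺ˡ ∘ proj₁ ∘ x∈p∩q⁻ p q
... | ↑ʳ-view i rewrite proj-↑ʳ i = x∉ ∘ ∈-++⁺ʳ p ∘ proj₂ ∘ x∈p∩q⁻ p q

∉∩⇒∃∉-++ : ∀ {n} {p q : Subset n} {i} → i ∉ p ∩ q → ∃ λ x → proj x ≡ i × x ∉ p ++ q
∉∩⇒∃∉-++ {n} {p} {i = i} i∉ with i ∈? p
... | no  i∉p = i ↑ˡ n , proj-↑ˡ i , i∉p ∘ ∈-++⁻ˡ i
... | yes i∈p = n ↑ʳ i , proj-↑ʳ i , λ ni∈ → i∉ (x∈p∩q⁺ (i∈p , ∈-++⁻ʳ p ni∈))

Reach-uncons : ∀ {n} {G : Graph n} {S u v} → Reach G S u v →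
               u ≡ v ⊎ ∃ λ w → adj G u w ≡ true × w ∉ S × Reach G S w v
Reach-uncons here           = inj₁ refl
Reach-uncons (step e w∉S r) = inj₂ (_ , e , w∉S , r)

adj⇒≢ : ∀ {n} (G : Graph n) {u v} → adj G u v ≡ true → u ≢ v
adj⇒≢ G {u} e refl with () ← trans (sym e) (irrefl G u)

isolated⇒Cut : ∀ {n} (G : Graph n) {S u} → u ∉ S → (∀ {w} → adj G u w ≡ true → w ∉ S → ⊥) → Cut G S
isolated⇒Cut G {S} {u} u∉ isolated with n∸∣p∣≤1⊎∉-pair S
... | inj₁ few = inj₁ few
... | inj₂ (a , b , a≢b , a∉ , b∉) with a ≟ᶠ u
...   | yes refl = inj₂ (u , b , u∉ , b∉ , [ a≢b , (λ (_ , e , w∉ , _) → isolated e w∉) ]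
                                               ∘ Reach-uncons)
...   | no  a≢u  = inj₂ (u , a , u∉ , a∉ , [ a≢u ∘ sym , (λ (_ , e , w∉ , _) → isolated e w∉) ]
                                               ∘ Reach-uncons)

module _ {n} (G : Graph n) where

  Reach-proj : ∀ {p q : Subset n} {x y} → Reach (double G) (p ++ q) x y → Reach G (p ∩ q) (proj x) (proj y)
  Reach-proj here             = here
  Reach-proj (step e z∉ r)    = step e (∉-++⇒proj∉∩ z∉) (Reach-proj r)

  Reach-lift : ∀ {p q : Subset n} {x y w} → y ∉ p ++ q → adj G (proj x) w ≡ true → w ∉ p ∩ q →
               Reach G (p ∩ q) w (proj y) → Reach (double G) (p ++ q) x y
  Reach-lift y∉ e w∉ here = step e y∉ here
  Reach-lift y∉ e w∉ (step e′ v∉ r) with ∉∩⇒∃∉-++ w∉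
  ... | z , refl , z∉ = step e z∉ (Reach-lift y∉ e′ v∉ r)

  Cut-double : ∀ {S} → Cut G S → Cut (double G) (S ++ S)
  Cut-double {S} (inj₂ (u , v , u∉ , v∉ , ¬r)) =
    inj₂ (u ↑ˡ n , v ↑ˡ n , u∉ ∘ ∈-++⁻ˡ u , v∉ ∘ ∈-++⁻ˡ v , ¬r ∘ project)
    where
    project : Reach (double G) (S ++ S) (u ↑ˡ n) (v ↑ˡ n) → Reach G S u v
    project r = subst₂ (Reach G S) (proj-↑ˡ u) (proj-↑ˡ v)
      (subst (λ A → Reach G A _ _) (∩-idem S) (Reach-proj r))
  -- At most one vertex of G survives, so the survivors in D[G] all lie over it and are pairwise
  -- non-adjacent because G is loopless.
  Cut-double {S} (inj₁ few) with ∣p∣≡n⊎∃∉ (S ++ S)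
  ... | inj₁ full = inj₁ (≤-trans (≤-reflexive (trans (cong (n + n ∸_) full) (n∸n≡0 (n + n)))) z≤n)
  ... | inj₂ (x , x∉) = isolated⇒Cut (double G) x∉ λ e z∉ →
    adj⇒≢ G e (n∸∣p∣≤1⇒∉-unique few (proj∉ x∉) (proj∉ z∉))
    where
    proj∉ : ∀ {z} → z ∉ S ++ S → proj z ∉ S
    proj∉ z∉ z∈ = ∉-++⇒proj∉∩ z∉ (x∈p∩q⁺ (z∈ , z∈))

  Cut-halve-∩ : ∀ {p q : Subset n} → Cut (double G) (p ++ q) → Cut G (p ∩ q)
  -- Two survivors of G would lift to two survivors of D[G].
  Cut-halve-∩ {p} {q} (inj₁ few) with n∸∣p∣≤1⊎∉-pair (p ∩ q)
  ... | inj₁ few′ = inj₁ few′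
  ... | inj₂ (a , b , a≢b , a∉ , b∉) with ∉∩⇒∃∉-++ a∉ | ∉∩⇒∃∉-++ b∉
  ...   | x , refl , x∉ | y , refl , y∉ = contradiction (cong proj (n∸∣p∣≤1⇒∉-unique few x∉ y∉)) a≢b
  Cut-halve-∩ {p} {q} (inj₂ (x , y , x∉ , y∉ , ¬r)) with proj x ≟ᶠ proj y
  ... | no  x≢y = inj₂ (proj x , proj y , ∉-++⇒proj∉∩ x∉ , ∉-++⇒proj∉∩ y∉ , [ x≢y , lift ] ∘ Reach-uncons)
    where
    lift : ¬ ∃ λ w → adj G (proj x) w ≡ true × w ∉ p ∩ q × Reach G (p ∩ q) w (proj y)
    lift (w , e , w∉ , r) = ¬r (Reach-lift y∉ e w∉ r)
  -- x and y lie over one vertex, which therefore has no neighbour outside p ∩ q.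
  ... | yes x≡y = isolated⇒Cut G (∉-++⇒proj∉∩ x∉) λ e w∉ → ¬r (Reach-lift y∉ e w∉ (back e))
    where
    back : ∀ {w} → adj G (proj x) w ≡ true → Reach G (p ∩ q) w (proj y)
    back e = step (trans (adj-sym G _ _) (subst (λ u → adj G u _ ≡ true) x≡y e))
                  (∉-++⇒proj∉∩ y∉) here

  Cut-halve : ∀ T → Cut (double G) T → ∃ λ S → Cut G S × 2 * ∣ S ∣ ≤ ∣ T ∣
  Cut-halve T cut with Vec.splitAt n T
  ... | p , q , refl = p ∩ q , Cut-halve-∩ cut , 2*∣p∩q∣≤∣p++q∣ p q

  IsConnectivity-double : ∀ {k} → IsConnectivity G k → IsConnectivity (double G) (2 * k)
  IsConnectivity-double {k} ((S , ∣S∣≡k , cut) , minimal) =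
    (S ++ S , trans (∣p++p∣≡2*∣p∣ S) (cong (2 *_) ∣S∣≡k) , Cut-double cut) , minimal′
    where
    minimal′ : ∀ T → Cut (double G) T → 2 * k ≤ ∣ T ∣
    minimal′ T cutT with Cut-halve T cutT
    ... | S′ , cutS′ , 2∣S′∣≤∣T∣ = ≤-trans (*-monoʳ-≤ 2 (minimal S′ cutS′)) 2∣S′∣≤∣T∣

  IsConnectivity-halve : ∀ {K} → IsConnectivity (double G) K → ∃ λ k → IsConnectivity G k × K ≡ 2 * k
  IsConnectivity-halve {K} ((T , ∣T∣≡K , cutT) , minimal) with Cut-halve T cutT
  ... | S , cutS , 2∣S∣≤∣T∣ = ∣ S ∣ , ((S , refl , cutS) , minimalS) , ≤-antisym (K≤2∣S′∣ S cutS) 2∣S∣≤K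
    where
    2∣S∣≤K : 2 * ∣ S ∣ ≤ K
    2∣S∣≤K = subst (2 * ∣ S ∣ ≤_) ∣T∣≡K 2∣S∣≤∣T∣
    K≤2∣S′∣ : ∀ S′ → Cut G S′ → K ≤ 2 * ∣ S′ ∣
    K≤2∣S′∣ S′ cut = subst (K ≤_) (∣p++p∣≡2*∣p∣ S′) (minimal (S′ ++ S′) (Cut-double cut))
    minimalS : ∀ S′ → Cut G S′ → ∣ S ∣ ≤ ∣ S′ ∣
    minimalS S′ cut = *-cancelˡ-≤ 2 (≤-trans 2∣S∣≤K (K≤2∣S′∣ S′ cut))

sum-tabulate : ∀ {n} (f : Fin n → ℕ) → ListAction.sum (tabulate f) ≡ ∑[ i < n ] f i
sum-tabulate {zero}  f = refl
sum-tabulate {suc n} f = cong (f zero +_) (sum-tabulate (f ∘ suc))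

sum-map-allFin : ∀ n (f : Fin n → ℕ) → ListAction.sum (map f (allFin n)) ≡ ∑[ i < n ] f i
sum-map-allFin n f = trans (cong ListAction.sum (map-tabulate id f)) (sum-tabulate f)

∑-↑ : ∀ m n (f : Fin (m + n) → ℕ) → ∑[ x < m + n ] f x ≡ ∑[ i < m ] f (i ↑ˡ n) + ∑[ j < n ] f (m ↑ʳ j)
∑-↑ zero    n f = refl
∑-↑ (suc m) n f = trans (cong (f zero +_) (∑-↑ m n (f ∘ suc))) (sym (+-assoc (f zero) _ _))

∑-proj : ∀ n (f : Fin n → ℕ) → ∑[ x < n + n ] f (proj x) ≡ 2 * ∑[ i < n ] f i
∑-proj n f = begin
  ∑[ x < n + n ] f (proj x)                                     ≡⟨ ∑-↑ n n (f ∘ proj) ⟩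
  ∑[ i < n ] f (proj (i ↑ˡ n)) + ∑[ j < n ] f (proj (n ↑ʳ j))  ≡⟨ cong₂ _+_ (sum-cong-≗ (cong f ∘ proj-↑ˡ))
                                                                              (sum-cong-≗ (cong f ∘ proj-↑ʳ)) ⟩
  ∑f + ∑f                                                       ≡⟨ cong (∑f +_) (+-identityʳ ∑f) ⟨
  2 * ∑f                                                        ∎
  where
  open ≡-Reasoning
  ∑f = ∑[ i < n ] f i

arc : ∀ {n} → Graph n → Fin n → Fin n → ℕ
arc G i j = if adj G i j then 1 else 0

forwardArc : ∀ {n} → Graph n → Fin n → Fin n → ℕ
forwardArc G i j = if ⌊ toℕ i <? toℕ j ⌋ ∧ adj G i j then 1 else 0

arcCount : ∀ {n} → Graph n → ℕ
arcCount {n} G = ∑[ i < n ] ∑[ j < n ] arc G i j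

edgeCount≡∑∑forwardArc : ∀ {n} (G : Graph n) → edgeCount G ≡ ∑[ i < n ] ∑[ j < n ] forwardArc G i j
edgeCount≡∑∑forwardArc {n} G = trans (sum-map-allFin n _) (sum-cong-≗ λ i → sum-map-allFin n (forwardArc G i))

arc≡forwardArc+forwardArc : ∀ {n} (G : Graph n) i j → arc G i j ≡ forwardArc G i j + forwardArc G j i
arc≡forwardArc+forwardArc G i j with <-cmp (toℕ i) (toℕ j)
... | tri< i<j _ j≮i
  rewrite dec-yes-recompute (toℕ i <? toℕ j) i<j | dec-no (toℕ j <? toℕ i) j≮i = sym (+-identityʳ _)
... | tri> i≮j _ j<i
  rewrite dec-no (toℕ i <? toℕ j) i≮j | dec-yes-recompute (toℕ j <? toℕ i) j<i =
    cong (λ b → if b then 1 else 0) (adj-sym G i j)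
... | tri≈ i≮j i≡j _ with refl ← toℕ-injective i≡j
  rewrite dec-no (toℕ i <? toℕ i) i≮j | irrefl G i = refl

arcCount≡2*edgeCount : ∀ {n} (G : Graph n) → arcCount G ≡ 2 * edgeCount G
arcCount≡2*edgeCount {n} G = begin
  arcCount G                                   ≡⟨ sum-cong-≗ (λ i → sum-cong-≗ (arc≡forwardArc+forwardArc G i)) ⟩
  ∑[ i < n ] ∑[ j < n ] (out i j + out j i)    ≡⟨ sum-cong-≗ (λ i → ∑-distrib-+ (out i) (λ j → out j i)) ⟩
  ∑[ i < n ] (∑[ j < n ] out i j + ∑[ j < n ] out j i)
                                               ≡⟨ ∑-distrib-+ (λ i → ∑[ j < n ] out i j) (λ i → ∑[ j < n ] out j i) ⟩
  E + ∑[ i < n ] ∑[ j < n ] out j i            ≡⟨ cong (E +_) (∑-comm (λ i j → out j i)) ⟩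
  E + E                                        ≡⟨ cong (E +_) (+-identityʳ E) ⟨
  2 * E                                        ≡⟨ cong (2 *_) (edgeCount≡∑∑forwardArc G) ⟨
  2 * edgeCount G                              ∎
  where
  open ≡-Reasoning
  out = forwardArc G
  E = ∑[ i < n ] ∑[ j < n ] out i j

arcCount-double : ∀ {n} (G : Graph n) → arcCount (double G) ≡ 2 * (2 * arcCount G)
arcCount-double {n} G = begin
  arcCount (double G)                                  ≡⟨ sum-cong-≗ (λ x → ∑-proj n (arc G (proj x))) ⟩
  ∑[ x < n + n ] (2 * ∑[ j < n ] arc G (proj x) j)     ≡⟨ ∑-proj n (λ i → 2 * ∑[ j < n ] arc G i j) ⟩
  2 * ∑[ i < n ] (2 * ∑[ j < n ] arc G i j)            ≡⟨ cong (2 *_) (*-distribˡ-sum 2 (λ i → ∑[ j < n ] arc G i j)) ⟨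
  2 * (2 * arcCount G)                                 ∎
  where open ≡-Reasoning

edgeCount-double : ∀ {n} (G : Graph n) → edgeCount (double G) ≡ 4 * edgeCount G
edgeCount-double G = *-cancelˡ-≡ _ _ 2 (begin
  2 * edgeCount (double G)             ≡⟨ arcCount≡2*edgeCount (double G) ⟨
  arcCount (double G)                  ≡⟨ arcCount-double G ⟩
  2 * (2 * arcCount G)                 ≡⟨ cong (λ a → 2 * (2 * a)) (arcCount≡2*edgeCount G) ⟩
  2 * (2 * (2 * edgeCount G))          ≡⟨ cong (2 *_) (*-assoc 2 2 (edgeCount G)) ⟨
  2 * (4 * edgeCount G)                ∎)
  where open ≡-Reasoning

theorem2p3 : ∀ (m : ℕ) (G : Graph (suc m)) (t t₀ : ℕ) →
    t₀ < suc m → edgeCount G ≡ t * suc m + t₀ →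
    (MaxKappa (double G) ⇔
      (MaxKappa G × ((4 * t₀ < suc m) ⊎ (suc m ≤ 2 * t₀ × 4 * t₀ < 3 * suc m))))
theorem2p3 m G t t₀ t₀<p q≡ = mk⇔ to from
  where
  target≡2*k⇔ : ∀ k → (2 * edgeCount (double G)) / (suc m + suc m) ≡ 2 * k ⇔
                      (k ≡ (2 * edgeCount G) / suc m × FirstOrThirdQuarter (suc m) t₀)
  target≡2*k⇔ k rewrite edgeCount-double G = [2*[4*q]]/[n+n]≡2*k⇔ {t = t} q≡ t₀<p k

  to : MaxKappa (double G) → MaxKappa G × FirstOrThirdQuarter (suc m) t₀
  to κD with k , κG , target≡2k ← IsConnectivity-halve G κD
             with refl , quarter ← Equivalence.to (target≡2*k⇔ k) target≡2k = κG , quarter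

  from : MaxKappa G × FirstOrThirdQuarter (suc m) t₀ → MaxKappa (double G)
  from (κG , quarter) = subst (IsConnectivity (double G))
    (sym (Equivalence.from (target≡2*k⇔ _) (refl , quarter))) (IsConnectivity-double G κG)
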